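{- For integers $d\ge m\ge1$, $$\sum_{k=0}^{d-m}\binom{d-m}{k}\prod_{i=0}^{k-1}(m+i+1-r)(i+r)\prod_{j=k+1}^{d-m}(d-m+r-j)(m+r+j)=\prod_{i=1}^{d-m}(m+i)(i-1+2r),$$ i.e. $\mathbf{P}^m_d(m)=\psi_{d-m}(m)$, where $\mathbf{P}^u_d(m)=\sum_{k=0}^{d-m}\binom{d-m}{k}\prod_{i=0}^{k-1}(m+i+1-r)(i+r)\prod_{j=k+1}^{d-m}(d-m+r-j)(u+r+j)$ and $\psi_k(x)=\prod_{i=1}^{k}(x+i)(i-1+2r)$.
   Context: $r$ is an indeterminate; the identity is one of polynomials in $r$. -}

module Defs where

open import Level using (Level)
open import Data.Nat as ℕ using (ℕ; zero; suc; _∸_)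
open import Data.Nat.Combinatorics using (_C_)
open import Algebra.Bundles using (CommutativeRing)

-- Everything is stated uniformly over an arbitrary commutative ring R and an
-- arbitrary element r of R; by the universal property of ℤ[r] this is exactly
-- the polynomial identity in the indeterminate r (take R = ℤ[r]).
module Poly {c ℓ : Level} (R : CommutativeRing c ℓ) where
  open CommutativeRing R

  ⟦_⟧ : ℕ → Carrier
  ⟦ zero ⟧ = 0#
  ⟦ suc n ⟧ = 1# + ⟦ n ⟧

  prodFrom : ℕ → ℕ → (ℕ → Carrier) → Carrier
  prodFrom a zero f = 1#
  prodFrom a (suc n) f = f a * prodFrom (suc a) n f

  sumTo : ℕ → (ℕ → Carrier) → Carrier
  sumTo zero f = f 0
  sumTo (suc n) f = sumTo n f + f (suc n)

  P : (r : Carrier) (u d m : ℕ) → Carrier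
  P r u d m = sumTo n λ k →
      ⟦ n C k ⟧
    * prodFrom 0 k (λ i → ((⟦ m ⟧ + ⟦ i ⟧ + 1#) - r) * (⟦ i ⟧ + r))
    * prodFrom (suc k) (n ∸ k) (λ j → ((⟦ n ⟧ + r) - ⟦ j ⟧) * (⟦ u ⟧ + r + ⟦ j ⟧))
    where n = d ∸ m

  ψ : (r : Carrier) (k x : ℕ) → Carrier
  ψ r k x = prodFrom 1 k (λ i → (⟦ x ⟧ + ⟦ i ⟧) * ((⟦ i ⟧ - 1#) + (r + r)))

module Submission where

-- Write T n k for the k-th summand of 𝐏^m_{m+n}(m), f i = (m+i+1-r)(i+r) and
-- h i = (m+i)(i-1+2r), so that ψ_{n+1}(m) = h(n+1) ψ_n(m).  Raising n by one
-- multiplies the second product of T n k by (r+n-k)(m+n+1+r); together with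
-- Pascal's rule and the absorption identity (n+1-k) C(n,k-1) = k C(n,k) this
-- gives the recurrence
--   T (n+1) k = (h(n+1) - f k) T n k + f (k-1) T n (k-1).
-- Summing over k, the f-terms telescope, so Σ_k T (n+1) k = h(n+1) Σ_k T n k,
-- and induction on n = d - m concludes.

open import Defs
open import Level using (Level)
open import Data.Nat using (ℕ; _≤_; _∸_)
open import Algebra.Bundles using (CommutativeRing)

open import Data.Nat as Nat using (zero; suc; z≤n; _<?_)
import Data.Nat.Properties as NatP
open import Data.Nat.Combinatorics
  using (_C_; nCk+nC[k+1]≡[n+1]C[k+1]; nCn≡1; nC1≡n; k>n⇒nCk≡0)
open import Data.Product using (_,_)
open import Relation.Nullary using (yes; no)
open import Relation.Binary.PropositionalEquality as ≡ using (_≡_)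

module _ where
  open Nat using (_+_; _*_)
  open ≡ using (refl; cong; sym; trans)

  [n∸k]*nCk≡[1+k]*nC[1+k] : ∀ n k → (n ∸ k) * (n C k) ≡ suc k * (n C suc k)
  [n∸k]*nCk≡[1+k]*nC[1+k] zero    zero    = refl
  [n∸k]*nCk≡[1+k]*nC[1+k] zero    (suc k) = sym (NatP.*-zeroʳ (suc (suc k)))
  [n∸k]*nCk≡[1+k]*nC[1+k] (suc n) zero    =
    trans (NatP.*-identityʳ (suc n)) (sym (trans (NatP.+-identityʳ _) (nC1≡n (suc n))))
  [n∸k]*nCk≡[1+k]*nC[1+k] (suc n) (suc k) = begin
    (n ∸ k) * (suc n C suc k)                ≡⟨ cong ((n ∸ k) *_) (nCk+nC[k+1]≡[n+1]C[k+1] n k) ⟨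
    (n ∸ k) * (c₀ + c₁)                      ≡⟨ NatP.*-distribˡ-+ (n ∸ k) c₀ c₁ ⟩
    (n ∸ k) * c₀ + (n ∸ k) * c₁              ≡⟨ cong (_+ (n ∸ k) * c₁) ([n∸k]*nCk≡[1+k]*nC[1+k] n k) ⟩
    suc k * c₁ + (n ∸ k) * c₁                ≡⟨ NatP.*-distribʳ-+ c₁ (suc k) (n ∸ k) ⟨
    (suc k + (n ∸ k)) * c₁                   ≡⟨ regroup ⟩
    (suc (suc k) + (n ∸ suc k)) * c₁         ≡⟨ NatP.*-distribʳ-+ c₁ (suc (suc k)) (n ∸ suc k) ⟩
    suc (suc k) * c₁ + (n ∸ suc k) * c₁      ≡⟨ cong (suc (suc k) * c₁ +_) ([n∸k]*nCk≡[1+k]*nC[1+k] n (suc k)) ⟩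
    suc (suc k) * c₁ + suc (suc k) * c₂      ≡⟨ NatP.*-distribˡ-+ (suc (suc k)) c₁ c₂ ⟨
    suc (suc k) * (c₁ + c₂)                  ≡⟨ cong (suc (suc k) *_) (nCk+nC[k+1]≡[n+1]C[k+1] n (suc k)) ⟩
    suc (suc k) * (suc n C suc (suc k))      ∎
    where
    open ≡.≡-Reasoning
    c₀ c₁ c₂ : ℕ
    c₀ = n C k
    c₁ = n C suc k
    c₂ = n C suc (suc k)
    -- both sides vanish when k ≥ n, since then c₁ = 0
    regroup : (suc k + (n ∸ k)) * c₁ ≡ (suc (suc k) + (n ∸ suc k)) * c₁
    regroup with k <? n
    ... | yes k<n = cong (_* c₁) (trans (cong (suc k +_) (NatP.+-∸-assoc 1 k<n)) (NatP.+-suc (suc k) (n ∸ suc k)))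
    ... | no k≮n rewrite k>n⇒nCk≡0 (Nat.s≤s (NatP.≮⇒≥ k≮n)) =
      trans (NatP.*-zeroʳ (suc k + (n ∸ k))) (sym (NatP.*-zeroʳ (suc (suc k) + (n ∸ suc k))))

-- The ring solver compares normal forms syntactically, so it needs a coefficient
-- ring with decidable equality mapping into R; ℤ works for every commutative ring.
module IntegerCoefficientSolver {c ℓ : Level} (R : CommutativeRing c ℓ) where
  open CommutativeRing R
  open import Data.Integer as ℤ using (ℤ; +_; -[1+_]; _⊖_; sign; ∣_∣; _◃_)
  import Data.Integer.Properties as ℤP
  open import Data.Sign as Sign using (Sign)
  open import Data.Maybe using (Maybe; just; nothing)
  open import Algebra.Solver.Ring.AlmostCommutativeRing using (fromCommutativeRing; _-Raw-AlmostCommutative⟶_)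
  open import Algebra.Properties.Ring ring using (-0#≈0#; -‿involutive; -‿+-comm; -‿distribˡ-*; -‿distribʳ-*)
  open import Algebra.Properties.CommutativeSemigroup +-commutativeSemigroup using (interchange)
  open import Algebra.Properties.Semiring.Mult.TCOptimised semiring using (_×_; ×-homo-+; ×1-homo-*; 1+×)
  open import Relation.Binary.Reasoning.Setoid setoid

  signed : Sign → Carrier → Carrier
  signed Sign.+ x = x
  signed Sign.- x = - x

  signed-cong : ∀ s {x y} → x ≈ y → signed s x ≈ signed s y
  signed-cong Sign.+ x≈y = x≈y
  signed-cong Sign.- x≈y = -‿cong x≈y

  signed-* : ∀ s t x y → signed (s Sign.* t) (x * y) ≈ signed s x * signed t y
  signed-* Sign.+ Sign.+ x y = refl
  signed-* Sign.+ Sign.- x y = -‿distribʳ-* x y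
  signed-* Sign.- Sign.+ x y = -‿distribˡ-* x y
  signed-* Sign.- Sign.- x y = begin
    x * y         ≈⟨ -‿involutive (x * y) ⟨
    - - (x * y)   ≈⟨ -‿cong (-‿distribˡ-* x y) ⟩
    - (- x * y)   ≈⟨ -‿distribʳ-* (- x) y ⟩
    - x * - y     ∎

  -- The optimised _×_ sends the literals 0 and 1 to 0# and 1# on the nose,
  -- so that constants in solver goals match the goal terms definitionally.
  ι : ℤ → Carrier
  ι i = signed (sign i) (∣ i ∣ × 1#)

  ι-◃ : ∀ s n → ι (s ◃ n) ≈ signed s (n × 1#)
  ι-◃ Sign.+ zero    = refl
  ι-◃ Sign.- zero    = sym -0#≈0#
  ι-◃ Sign.+ (suc n) = refl
  ι-◃ Sign.- (suc n) = refl

  ι-* : ∀ i j → ι (i ℤ.* j) ≈ ι i * ι j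
  ι-* i j = begin
    ι (i ℤ.* j)                                 ≈⟨ ι-◃ s (∣ i ∣ Nat.* ∣ j ∣) ⟩
    signed s ((∣ i ∣ Nat.* ∣ j ∣) × 1#)        ≈⟨ signed-cong s (×1-homo-* ∣ i ∣ ∣ j ∣) ⟩
    signed s (∣ i ∣ × 1# * ∣ j ∣ × 1#)         ≈⟨ signed-* (sign i) (sign j) _ _ ⟩
    ι i * ι j                                   ∎
    where
    s : Sign
    s = sign i Sign.* sign j

  a-b≈[c+a]-[c+b] : ∀ a b c → a - b ≈ (c + a) - (c + b)
  a-b≈[c+a]-[c+b] a b c = begin
    a - b               ≈⟨ +-identityˡ (a - b) ⟨
    0# + (a - b)        ≈⟨ +-congʳ (-‿inverseʳ c) ⟨
    (c - c) + (a - b)   ≈⟨ interchange c (- c) a (- b) ⟩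
    (c + a) + (- c - b) ≈⟨ +-congˡ (-‿+-comm c b) ⟩
    (c + a) - (c + b)   ∎

  ι-⊖ : ∀ m n → ι (m ⊖ n) ≈ m × 1# - n × 1#
  ι-⊖ m       zero    = begin
    ι (m ⊖ 0)    ≈⟨ reflexive (≡.cong ι (ℤP.⊖-≥ {m} z≤n)) ⟩
    m × 1#       ≈⟨ +-identityʳ (m × 1#) ⟨
    m × 1# + 0#  ≈⟨ +-congˡ -0#≈0# ⟨
    m × 1# - 0#  ∎
  ι-⊖ zero    (suc n) = sym (+-identityˡ _)
  ι-⊖ (suc m) (suc n) = begin
    ι (suc m ⊖ suc n)              ≈⟨ reflexive (≡.cong ι (ℤP.[1+m]⊖[1+n]≡m⊖n m n)) ⟩
    ι (m ⊖ n)                      ≈⟨ ι-⊖ m n ⟩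
    m × 1# - n × 1#                ≈⟨ a-b≈[c+a]-[c+b] (m × 1#) (n × 1#) 1# ⟩
    (1# + m × 1#) - (1# + n × 1#)  ≈⟨ +-cong (1+× m 1#) (-‿cong (1+× n 1#)) ⟨
    suc m × 1# - suc n × 1#        ∎

  ι-+ : ∀ i j → ι (i ℤ.+ j) ≈ ι i + ι j
  ι-+ (+ m)     (+ n)     = ×-homo-+ 1# m n
  ι-+ (+ m)     -[1+ n ]  = ι-⊖ m (suc n)
  ι-+ -[1+ m ]  (+ n)     = trans (ι-⊖ n (suc m)) (+-comm _ _)
  ι-+ -[1+ m ]  -[1+ n ]  = begin
    - (suc (suc (m Nat.+ n)) × 1#)      ≈⟨ -‿cong (reflexive (≡.cong (λ i → suc i × 1#) (≡.sym (NatP.+-suc m n)))) ⟩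
    - ((suc m Nat.+ suc n) × 1#)        ≈⟨ -‿cong (×-homo-+ 1# (suc m) (suc n)) ⟩
    - (suc m × 1# + suc n × 1#)         ≈⟨ -‿+-comm _ _ ⟨
    - (suc m × 1#) - suc n × 1#         ∎

  ι-‿ : ∀ i → ι (ℤ.- i) ≈ - ι i
  ι-‿ (+ zero)  = sym -0#≈0#
  ι-‿ (+ suc n) = refl
  ι-‿ -[1+ n ]  = sym (-‿involutive _)

  ι-homomorphism : ℤ.+-*-rawRing -Raw-AlmostCommutative⟶ fromCommutativeRing R
  ι-homomorphism = record
    { ⟦_⟧ = ι ; +-homo = ι-+ ; *-homo = ι-* ; -‿homo = ι-‿ ; 0-homo = refl ; 1-homo = refl }

  ι-dec : ∀ i j → Maybe (ι i ≈ ι j)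
  ι-dec i j with i ℤ.≟ j
  ... | yes ≡.refl = just refl
  ... | no _       = nothing

  open import Algebra.Solver.Ring ℤ.+-*-rawRing (fromCommutativeRing R) ι-homomorphism ι-dec public

  𝟘 𝟙 : ∀ {n} → Polynomial n
  𝟘 = con (+ 0)
  𝟙 = con (+ 1)

module PolyProperties {c ℓ : Level} (R : CommutativeRing c ℓ) where
  open CommutativeRing R
  open Poly R
  open IntegerCoefficientSolver R using (solve; _:=_; _:+_; _:*_; _:-_)
  open import Algebra.Properties.Ring ring using ([y-z]x≈yx-zx)
  open import Relation.Binary.Reasoning.Setoid setoid

  ⟦⟧-+ : ∀ a b → ⟦ a Nat.+ b ⟧ ≈ ⟦ a ⟧ + ⟦ b ⟧
  ⟦⟧-+ zero    b = sym (+-identityˡ _)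
  ⟦⟧-+ (suc a) b = trans (+-congˡ (⟦⟧-+ a b)) (sym (+-assoc _ _ _))

  ⟦⟧-* : ∀ a b → ⟦ a Nat.* b ⟧ ≈ ⟦ a ⟧ * ⟦ b ⟧
  ⟦⟧-* zero    b = sym (zeroˡ _)
  ⟦⟧-* (suc a) b = begin
    ⟦ b Nat.+ a Nat.* b ⟧        ≈⟨ ⟦⟧-+ b (a Nat.* b) ⟩
    ⟦ b ⟧ + ⟦ a Nat.* b ⟧        ≈⟨ +-cong (sym (*-identityˡ _)) (⟦⟧-* a b) ⟩
    1# * ⟦ b ⟧ + ⟦ a ⟧ * ⟦ b ⟧   ≈⟨ distribʳ _ _ _ ⟨
    (1# + ⟦ a ⟧) * ⟦ b ⟧         ∎

  prodFrom-suc : ∀ a l F → prodFrom a (suc l) F ≈ prodFrom a l F * F (a Nat.+ l)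
  prodFrom-suc a zero    F = trans (*-comm _ _) (*-congˡ (reflexive (≡.cong F (≡.sym (NatP.+-identityʳ a)))))
  prodFrom-suc a (suc l) F = begin
    F a * prodFrom (suc a) (suc l) F                 ≈⟨ *-congˡ (prodFrom-suc (suc a) l F) ⟩
    F a * (prodFrom (suc a) l F * F (suc a Nat.+ l)) ≈⟨ *-assoc _ _ _ ⟨
    F a * prodFrom (suc a) l F * F (suc a Nat.+ l)   ≈⟨ *-congˡ (reflexive (≡.cong F (≡.sym (NatP.+-suc a l)))) ⟩
    F a * prodFrom (suc a) l F * F (a Nat.+ suc l)   ∎

  previous : (ℕ → Carrier) → ℕ → Carrier
  previous w zero    = 0#
  previous w (suc k) = w k

  sumTo-telescoping : ∀ N x (a t u : ℕ → Carrier) →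
    (∀ k → k ≤ N → u k ≈ (x - a k) * t k + previous (λ j → a j * t j) k) →
    sumTo N u ≈ x * sumTo N t - a N * t N
  sumTo-telescoping zero x a t u u≈ = trans (u≈ 0 z≤n) (trans (+-identityʳ _) ([y-z]x≈yx-zx (t 0) x (a 0)))
  sumTo-telescoping (suc N) x a t u u≈ = begin
    sumTo N u + u (suc N)
      ≈⟨ +-cong (sumTo-telescoping N x a t u (λ k k≤N → u≈ k (NatP.m≤n⇒m≤1+n k≤N))) (u≈ (suc N) NatP.≤-refl) ⟩
    (x * sumTo N t - a N * t N) + ((x - a (suc N)) * t (suc N) + a N * t N)
      ≈⟨ solve 6 (λ x s aN tN a t → (x :* s :- aN :* tN) :+ ((x :- a) :* t :+ aN :* tN) := x :* (s :+ t) :- a :* t)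
           refl x (sumTo N t) (a N) (t N) (a (suc N)) (t (suc N)) ⟩
    x * (sumTo N t + t (suc N)) - a (suc N) * t (suc N)
      ∎

module SummandRecurrence {c ℓ : Level} (R : CommutativeRing c ℓ) (r : CommutativeRing.Carrier R) (m : ℕ) where
  open CommutativeRing R
  open Poly R
  open PolyProperties R
  open IntegerCoefficientSolver R using (solve; _:=_; _:+_; _:*_; _:-_; 𝟘; 𝟙)
  open import Relation.Binary.Reasoning.Setoid setoid

  M : Carrier
  M = ⟦ m ⟧

  f : ℕ → Carrier
  f i = ((M + ⟦ i ⟧ + 1#) - r) * (⟦ i ⟧ + r)

  g : ℕ → ℕ → Carrier
  g n j = ((⟦ n ⟧ + r) - ⟦ j ⟧) * (M + r + ⟦ j ⟧)

  h : ℕ → Carrier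
  h i = (M + ⟦ i ⟧) * ((⟦ i ⟧ - 1#) + (r + r))

  A : ℕ → Carrier
  A k = prodFrom 0 k f

  T : ℕ → ℕ → Carrier
  T n k = ⟦ n C k ⟧ * A k * prodFrom (suc k) (n ∸ k) (g n)

  E : ℕ → ℕ → Carrier
  E k l = prodFrom (suc k) l (g (k Nat.+ l))

  T≈⟦C⟧*A*E : ∀ {n} k l → k Nat.+ l ≡ n → T n k ≈ ⟦ n C k ⟧ * A k * E k l
  T≈⟦C⟧*A*E k l ≡.refl = reflexive (≡.cong (λ i → ⟦ (k Nat.+ l) C k ⟧ * A k * prodFrom (suc k) i (g (k Nat.+ l)))
                                    (NatP.m+n∸m≡n k l))

  T-diagonal : ∀ n → T n n ≈ A n
  T-diagonal n = begin
    T n n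
      ≈⟨ reflexive (≡.cong₂ (λ a b → ⟦ a ⟧ * A n * prodFrom (suc n) b (g n)) (nCn≡1 n) (NatP.n∸n≡0 n)) ⟩
    (1# + 0#) * A n * 1#
      ≈⟨ solve 1 (λ a → (𝟙 :+ 𝟘) :* a :* 𝟙 := a) refl (A n) ⟩
    A n
      ∎

  E-peel : ∀ k l → E k (suc l) ≈ ((⟦ l ⟧ + r) * (M + r + ⟦ suc k ⟧)) * E (suc k) l
  E-peel k l = begin
    E k (suc l)
      ≈⟨ reflexive (≡.cong (λ n → g n (suc k) * prodFrom (suc (suc k)) l (g n)) (NatP.+-suc k l)) ⟩
    g (suc (k Nat.+ l)) (suc k) * E (suc k) l
      ≈⟨ *-congʳ (*-congʳ gap) ⟩
    ((⟦ l ⟧ + r) * (M + r + ⟦ suc k ⟧)) * E (suc k) l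
      ∎
    where
    gap : (⟦ suc (k Nat.+ l) ⟧ + r) - ⟦ suc k ⟧ ≈ ⟦ l ⟧ + r
    gap = begin
      ((1# + ⟦ k Nat.+ l ⟧) + r) - (1# + ⟦ k ⟧)     ≈⟨ +-congʳ (+-congʳ (+-congˡ (⟦⟧-+ k l))) ⟩
      ((1# + (⟦ k ⟧ + ⟦ l ⟧)) + r) - (1# + ⟦ k ⟧)   ≈⟨ solve 3 (λ r K L → ((𝟙 :+ (K :+ L)) :+ r) :- (𝟙 :+ K) := L :+ r) refl r ⟦ k ⟧ ⟦ l ⟧ ⟩
      ⟦ l ⟧ + r                                     ∎

  E-suc : ∀ k l → E k (suc l) ≈ ((r + ⟦ l ⟧) * (M + (1# + (⟦ k ⟧ + ⟦ l ⟧)) + r)) * E k l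
  E-suc k zero    = begin
    E k 1
      ≈⟨ E-peel k 0 ⟩
    ((0# + r) * (M + r + (1# + ⟦ k ⟧))) * 1#
      ≈⟨ solve 3 (λ r M K → ((𝟘 :+ r) :* (M :+ r :+ (𝟙 :+ K))) :* 𝟙
                            := ((r :+ 𝟘) :* (M :+ (𝟙 :+ (K :+ 𝟘)) :+ r)) :* 𝟙)
           refl r M ⟦ k ⟧ ⟩
    ((r + 0#) * (M + (1# + (⟦ k ⟧ + 0#)) + r)) * 1#
      ∎
  E-suc k (suc l) = begin
    E k (suc (suc l))
      ≈⟨ E-peel k (suc l) ⟩
    ((1# + L + r) * (M + r + (1# + K))) * E (suc k) (suc l)
      ≈⟨ *-congˡ (E-suc (suc k) l) ⟩
    ((1# + L + r) * (M + r + (1# + K))) * (((r + L) * (M + (1# + ((1# + K) + L)) + r)) * E (suc k) l)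
      ≈⟨ solve 5 (λ r M K L e →
           ((𝟙 :+ L :+ r) :* (M :+ r :+ (𝟙 :+ K))) :* (((r :+ L) :* (M :+ (𝟙 :+ ((𝟙 :+ K) :+ L)) :+ r)) :* e)
           := ((r :+ (𝟙 :+ L)) :* (M :+ (𝟙 :+ (K :+ (𝟙 :+ L))) :+ r)) :* (((L :+ r) :* (M :+ r :+ (𝟙 :+ K))) :* e))
           refl r M K L (E (suc k) l) ⟩
    ((r + (1# + L)) * (M + (1# + (K + (1# + L))) + r)) * (((L + r) * (M + r + (1# + K))) * E (suc k) l)
      ≈⟨ *-congˡ (E-peel k l) ⟨
    ((r + (1# + L)) * (M + (1# + (K + (1# + L))) + r)) * E k (suc l)
      ∎
    where
    K L : Carrier
    K = ⟦ k ⟧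
    L = ⟦ l ⟧

  h-f-factor : ∀ k l → h (suc (k Nat.+ l)) - f k ≈ (r + ⟦ l ⟧) * (M + (1# + (⟦ k ⟧ + ⟦ l ⟧)) + r + ⟦ k ⟧)
  h-f-factor k l = begin
    H (1# + ⟦ k Nat.+ l ⟧) - f k        ≈⟨ +-congʳ (H-cong (+-congˡ (⟦⟧-+ k l))) ⟩
    H (1# + (⟦ k ⟧ + ⟦ l ⟧)) - f k      ≈⟨ solve 4 (λ r M K L →
                                             let N = 𝟙 :+ (K :+ L) in
                                             (M :+ N) :* ((N :- 𝟙) :+ (r :+ r)) :- ((M :+ K :+ 𝟙) :- r) :* (K :+ r)
                                             := (r :+ L) :* (M :+ N :+ r :+ K))
                                             refl r M ⟦ k ⟧ ⟦ l ⟧ ⟩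
    (r + ⟦ l ⟧) * (M + (1# + (⟦ k ⟧ + ⟦ l ⟧)) + r + ⟦ k ⟧) ∎
    where
    H : Carrier → Carrier
    H x = (M + x) * ((x - 1#) + (r + r))
    H-cong : ∀ {x y} → x ≈ y → H x ≈ H y
    H-cong x≈y = *-cong (+-congˡ x≈y) (+-congʳ (+-congʳ x≈y))

  T-suc-suc : ∀ k l → let n = suc k Nat.+ l in
    T (suc n) (suc k) ≈ (h (suc n) - f (suc k)) * T n (suc k) + f k * T n k
  T-suc-suc k l = begin
    T (suc n) (suc k)
      ≈⟨ T≈⟦C⟧*A*E (suc k) (suc l) (≡.cong suc (NatP.+-suc k l)) ⟩
    ⟦ suc n C suc k ⟧ * A (suc k) * E (suc k) (suc l)
      ≈⟨ *-cong (*-cong pascal (prodFrom-suc 0 k f)) (E-suc (suc k) l) ⟩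
    (Y + X) * (A k * f k) * (((r + L) * Q) * e)
      ≈⟨ solve 9 (λ r M K L X Y a φ e →
           (Y :+ X) :* (a :* φ) :* (((r :+ L) :* (M :+ (𝟙 :+ ((𝟙 :+ K) :+ L)) :+ r)) :* e)
           := (r :+ L) :* (a :* φ :* e) :* ((𝟙 :+ L) :* Y :- (𝟙 :+ K) :* X)
              :+ (((r :+ L) :* (M :+ (𝟙 :+ ((𝟙 :+ K) :+ L)) :+ r :+ (𝟙 :+ K))) :* (X :* (a :* φ) :* e)
                  :+ φ :* (Y :* a :* (((L :+ r) :* (M :+ r :+ (𝟙 :+ K))) :* e))))
           refl r M K L X Y (A k) (f k) e ⟩
    (r + L) * (A k * f k * e) * (⟦ suc l ⟧ * Y - ⟦ suc k ⟧ * X) + rest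
      ≈⟨ +-congʳ (*-congˡ (trans (+-congˡ (-‿cong (sym absorption))) (-‿inverseʳ _))) ⟩
    (r + L) * (A k * f k * e) * 0# + rest
      ≈⟨ trans (+-congʳ (zeroʳ _)) (+-identityˡ rest) ⟩
    rest
      ≈⟨ +-cong (*-cong (sym (h-f-factor (suc k) l)) (sym T[n,1+k])) (*-congˡ (sym T[n,k])) ⟩
    (h (suc n) - f (suc k)) * T n (suc k) + f k * T n k
      ∎
    where
    n : ℕ
    n = suc k Nat.+ l
    K L X Y Q e G : Carrier
    K = ⟦ k ⟧
    L = ⟦ l ⟧
    X = ⟦ n C suc k ⟧
    Y = ⟦ n C k ⟧
    Q = M + (1# + (⟦ suc k ⟧ + L)) + r
    e = E (suc k) l
    G = (L + r) * (M + r + ⟦ suc k ⟧)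
    rest : Carrier
    rest = (r + L) * (Q + ⟦ suc k ⟧) * (X * (A k * f k) * e) + f k * (Y * A k * (G * e))

    pascal : ⟦ suc n C suc k ⟧ ≈ Y + X
    pascal = trans (reflexive (≡.cong ⟦_⟧ (≡.sym (nCk+nC[k+1]≡[n+1]C[k+1] n k)))) (⟦⟧-+ (n C k) (n C suc k))

    absorption : ⟦ suc l ⟧ * Y ≈ ⟦ suc k ⟧ * X
    absorption = begin
      ⟦ suc l ⟧ * Y                   ≈⟨ ⟦⟧-* (suc l) (n C k) ⟨
      ⟦ suc l Nat.* (n C k) ⟧         ≈⟨ reflexive (≡.cong ⟦_⟧ (≡.trans (≡.cong (λ i → i Nat.* (n C k)) n∸k≡1+l)
                                                                        ([n∸k]*nCk≡[1+k]*nC[1+k] n k))) ⟩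
      ⟦ suc k Nat.* (n C suc k) ⟧     ≈⟨ ⟦⟧-* (suc k) (n C suc k) ⟩
      ⟦ suc k ⟧ * X                   ∎
      where
      n∸k≡1+l : suc l ≡ n ∸ k
      n∸k≡1+l = ≡.trans (≡.sym (NatP.m+n∸m≡n k (suc l))) (≡.cong (_∸ k) (NatP.+-suc k l))

    T[n,1+k] : T n (suc k) ≈ X * (A k * f k) * e
    T[n,1+k] = trans (T≈⟦C⟧*A*E (suc k) l ≡.refl) (*-congʳ (*-congˡ (prodFrom-suc 0 k f)))

    T[n,k] : T n k ≈ Y * A k * (G * e)
    T[n,k] = trans (T≈⟦C⟧*A*E k (suc l) (NatP.+-suc k l)) (*-congˡ (E-peel k l))

  T-suc : ∀ n k → k ≤ n → T (suc n) k ≈ (h (suc n) - f k) * T n k + previous (λ j → f j * T n j) k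
  T-suc n zero _ = begin
    T (suc n) 0
      ≈⟨ *-congˡ (E-suc 0 n) ⟩
    (1# + 0#) * 1# * (((r + N) * (M + (1# + (0# + N)) + r)) * E 0 n)
      ≈⟨ solve 4 (λ r M N e →
           (𝟙 :+ 𝟘) :* 𝟙 :* (((r :+ N) :* (M :+ (𝟙 :+ (𝟘 :+ N)) :+ r)) :* e)
           := ((r :+ N) :* (M :+ (𝟙 :+ (𝟘 :+ N)) :+ r :+ 𝟘)) :* ((𝟙 :+ 𝟘) :* 𝟙 :* e) :+ 𝟘)
           refl r M N (E 0 n) ⟩
    ((r + N) * (M + (1# + (0# + N)) + r + 0#)) * T n 0 + 0#
      ≈⟨ +-congʳ (*-congʳ (h-f-factor 0 n)) ⟨
    (h (suc n) - f 0) * T n 0 + 0#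
      ∎
    where
    N : Carrier
    N = ⟦ n ⟧
  T-suc n (suc k) k<n with NatP.m≤n⇒∃[o]m+o≡n k<n
  ... | l , ≡.refl = T-suc-suc k l

  sumTo-T≈prodFrom-h : ∀ n → sumTo n (T n) ≈ prodFrom 1 n h
  sumTo-T≈prodFrom-h zero    = T-diagonal 0
  sumTo-T≈prodFrom-h (suc n) = begin
    sumTo n (T (suc n)) + T (suc n) (suc n)
      ≈⟨ +-cong (sumTo-telescoping n (h (suc n)) f (T n) (T (suc n)) (T-suc n)) (T-diagonal (suc n)) ⟩
    (h (suc n) * sumTo n (T n) - f n * T n n) + A (suc n)
      ≈⟨ +-congˡ (trans (prodFrom-suc 0 n f) (trans (*-comm _ _) (*-congˡ (sym (T-diagonal n))))) ⟩
    (h (suc n) * sumTo n (T n) - f n * T n n) + f n * T n n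
      ≈⟨ solve 2 (λ x y → x :- y :+ y := x) refl (h (suc n) * sumTo n (T n)) (f n * T n n) ⟩
    h (suc n) * sumTo n (T n)
      ≈⟨ *-congˡ (sumTo-T≈prodFrom-h n) ⟩
    h (suc n) * prodFrom 1 n h
      ≈⟨ *-comm _ _ ⟩
    prodFrom 1 n h * h (suc n)
      ≈⟨ prodFrom-suc 1 n h ⟨
    prodFrom 1 (suc n) h
      ∎

corollary5p8 : {c ℓ : Level} (R : CommutativeRing c ℓ) (r : CommutativeRing.Carrier R)
    (m d : ℕ) → 1 ≤ m → m ≤ d →
    CommutativeRing._≈_ R (Poly.P R r m d m) (Poly.ψ R r (d ∸ m) m)
corollary5p8 R r m d _ _ = SummandRecurrence.sumTo-T≈prodFrom-h R r m (d ∸ m)
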